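{- Let $(\mathcal D,\otimes,I)$ be a symmetric monoidal closed category with countable coproducts and let $\mathcal E$ be a class of epimorphisms of $\mathcal D$ containing all isomorphisms and closed under composition. Suppose that $\mathcal D$ is stable with respect to $\mathcal E$, that $\mathcal E$ is closed under wide pushouts and under tensor products, and that $\mathcal D$ has wide pushouts of $\mathcal E$-morphisms. Then for all objects $X,Y$ every language $L:X^*\to Y$ has a syntactic $\mathcal D$-monoid.
   Context: $X^*=\coprod_{n<\omega}X^{\otimes n}$ is the free monoid object ($\mathcal D$-monoid) on $X$. A language is a morphism $L:X^*\to Y$. A $\mathcal D$-monoid morphism $e:X^*\to M$ recognizes $L$ if $L=f\circ e$ for some morphism $f:M\to Y$. An $X$-generated $\mathcal D$-monoid is a $\mathcal D$-monoid morphism $e:X^*\to M$ lying in $\mathcal E$; for two such, $e_1\le e_2$ iff $e_1=h\circ e_2$ for some $\mathcal D$-monoid morphism $h$. A syntactic $\mathcal D$-monoid of $L$ is an $X$-generated $\mathcal D$-monoid $e_L:X^*\to\mathrm{Syn}(L)$ recognizing $L$ such that $e_L\le e$ for every $X$-generated $\mathcal D$-monoid $e$ recognizing $L$. Stability: for $a:A\to A'$, $b:B\to B'$ in $\mathcal E$ the square formed by $a\otimes B$, $A\otimes b$, $A'\otimes b$, $a\otimes B'$ is a pushout. Closure of $\mathcal E$ under wide pushouts: the morphisms of a wide pushout of a family of $\mathcal E$-morphisms lie in $\mathcal E$; under tensor products: $a,b\in\mathcal E\Rightarrow a\otimes b\in\mathcal E$. -}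

module Defs where

open import Level using (Level; _⊔_) renaming (suc to lsuc)
import Level
open import Data.Nat using (ℕ; zero; suc; _+_)
open import Data.Product using (Σ; _×_; _,_)
open import Function.Bundles using (_↣_)
open import Function.Construct.Identity using (↣-id)
open import Relation.Binary using (Rel; IsEquivalence)

record Category (o ℓ e : Level) : Set (lsuc (o ⊔ ℓ ⊔ e)) where
  infixr 9 _∘_
  infix 4 _≈_
  field
    Obj : Set o
    _⇒_ : Obj → Obj → Set ℓ
    _≈_ : ∀ {A B} → Rel (A ⇒ B) e
    id  : ∀ {A} → A ⇒ A
    _∘_ : ∀ {A B C} → B ⇒ C → A ⇒ B → A ⇒ C
    assoc : ∀ {A B C D} {f : A ⇒ B} {g : B ⇒ C} {h : C ⇒ D} →
            (h ∘ g) ∘ f ≈ h ∘ (g ∘ f)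
    identityˡ : ∀ {A B} {f : A ⇒ B} → id ∘ f ≈ f
    identityʳ : ∀ {A B} {f : A ⇒ B} → f ∘ id ≈ f
    equiv : ∀ {A B} → IsEquivalence (_≈_ {A} {B})
    ∘-resp-≈ : ∀ {A B C} {f h : B ⇒ C} {g i : A ⇒ B} →
               f ≈ h → g ≈ i → f ∘ g ≈ h ∘ i

module _ {o ℓ e : Level} (C : Category o ℓ e) where
  open Category C

  IsEpi : ∀ {A B} → A ⇒ B → Set (o ⊔ ℓ ⊔ e)
  IsEpi {A} {B} f = ∀ {Z} (g h : B ⇒ Z) → g ∘ f ≈ h ∘ f → g ≈ h

  IsIso : ∀ {A B} → A ⇒ B → Set (ℓ ⊔ e)
  IsIso {A} {B} f = Σ (B ⇒ A) λ g → (g ∘ f ≈ id) × (f ∘ g ≈ id)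

  -- a class of morphisms (closed under ≈, i.e. a class of morphisms of the
  -- underlying category whose hom-sets are the quotients by ≈)
  MorphClass : (p : Level) → Set (o ⊔ ℓ ⊔ lsuc p)
  MorphClass p = ∀ {A B} → A ⇒ B → Set p

  record IsPushout {A B D P : Obj} (f : A ⇒ B) (g : A ⇒ D)
                   (i₁ : B ⇒ P) (i₂ : D ⇒ P) : Set (o ⊔ ℓ ⊔ e) where
    field
      commute   : i₁ ∘ f ≈ i₂ ∘ g
      universal : ∀ {Q} (h₁ : B ⇒ Q) (h₂ : D ⇒ Q) → h₁ ∘ f ≈ h₂ ∘ g →
                  Σ (P ⇒ Q) λ u → (u ∘ i₁ ≈ h₁) × (u ∘ i₂ ≈ h₂)
      unique    : ∀ {Q} (u v : P ⇒ Q) → u ∘ i₁ ≈ v ∘ i₁ → u ∘ i₂ ≈ v ∘ i₂ → u ≈ v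

  record WidePushout {ι : Level} {I : Set ι} {A : Obj} {B : I → Obj}
                     (f : ∀ i → A ⇒ B i) : Set (o ⊔ ℓ ⊔ e ⊔ ι) where
    field
      P       : Obj
      p₀      : A ⇒ P
      inj     : ∀ i → B i ⇒ P
      commute : ∀ i → inj i ∘ f i ≈ p₀
      universal : ∀ {Q} (q₀ : A ⇒ Q) (q : ∀ i → B i ⇒ Q) →
                  (∀ i → q i ∘ f i ≈ q₀) →
                  Σ (P ⇒ Q) λ u → (u ∘ p₀ ≈ q₀) × (∀ i → u ∘ inj i ≈ q i)
      unique  : ∀ {Q} (u v : P ⇒ Q) → u ∘ p₀ ≈ v ∘ p₀ →
                (∀ i → u ∘ inj i ≈ v ∘ inj i) → u ≈ v

  record Coproduct {I : Set} (A : I → Obj) : Set (o ⊔ ℓ ⊔ e) where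
    field
      ∐      : Obj
      ι      : ∀ i → A i ⇒ ∐
      copair : ∀ {Z} → (∀ i → A i ⇒ Z) → ∐ ⇒ Z
      inject : ∀ {Z} (g : ∀ i → A i ⇒ Z) i → copair g ∘ ι i ≈ g i
      unique : ∀ {Z} (g : ∀ i → A i ⇒ Z) (h : ∐ ⇒ Z) →
               (∀ i → h ∘ ι i ≈ g i) → h ≈ copair g

  -- countable coproducts: coproducts of all families indexed by countable
  -- (finite or countably infinite) sets, i.e. sets injecting into ℕ
  CountableCoproducts : Set (lsuc Level.zero ⊔ o ⊔ ℓ ⊔ e)
  CountableCoproducts = (I : Set) → I ↣ ℕ → (A : I → Obj) → Coproduct A

module _ {o ℓ e : Level} (C : Category o ℓ e) where
  open Category C

  record Monoidal : Set (o ⊔ ℓ ⊔ e) where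
    infixr 10 _⊗₀_ _⊗₁_
    field
      _⊗₀_ : Obj → Obj → Obj
      _⊗₁_ : ∀ {A B C D} → A ⇒ B → C ⇒ D → (A ⊗₀ C) ⇒ (B ⊗₀ D)
      ⊗-identity : ∀ {A B} → id {A} ⊗₁ id {B} ≈ id
      ⊗-homomorphism : ∀ {A B C D E F} {f : A ⇒ B} {g : B ⇒ C}
                         {h : D ⇒ E} {k : E ⇒ F} →
                       (g ∘ f) ⊗₁ (k ∘ h) ≈ (g ⊗₁ k) ∘ (f ⊗₁ h)
      ⊗-resp-≈ : ∀ {A B C D} {f g : A ⇒ B} {h k : C ⇒ D} →
                 f ≈ g → h ≈ k → f ⊗₁ h ≈ g ⊗₁ k
      unit : Obj
      λ⇒ : ∀ {A} → (unit ⊗₀ A) ⇒ A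
      λ⇐ : ∀ {A} → A ⇒ (unit ⊗₀ A)
      λ-isoˡ : ∀ {A} → λ⇐ {A} ∘ λ⇒ ≈ id
      λ-isoʳ : ∀ {A} → λ⇒ {A} ∘ λ⇐ ≈ id
      λ-natural : ∀ {A B} (f : A ⇒ B) → f ∘ λ⇒ ≈ λ⇒ ∘ (id ⊗₁ f)
      ρ⇒ : ∀ {A} → (A ⊗₀ unit) ⇒ A
      ρ⇐ : ∀ {A} → A ⇒ (A ⊗₀ unit)
      ρ-isoˡ : ∀ {A} → ρ⇐ {A} ∘ ρ⇒ ≈ id
      ρ-isoʳ : ∀ {A} → ρ⇒ {A} ∘ ρ⇐ ≈ id
      ρ-natural : ∀ {A B} (f : A ⇒ B) → f ∘ ρ⇒ ≈ ρ⇒ ∘ (f ⊗₁ id)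
      α⇒ : ∀ {A B C} → ((A ⊗₀ B) ⊗₀ C) ⇒ (A ⊗₀ (B ⊗₀ C))
      α⇐ : ∀ {A B C} → (A ⊗₀ (B ⊗₀ C)) ⇒ ((A ⊗₀ B) ⊗₀ C)
      α-isoˡ : ∀ {A B C} → α⇐ {A} {B} {C} ∘ α⇒ ≈ id
      α-isoʳ : ∀ {A B C} → α⇒ {A} {B} {C} ∘ α⇐ ≈ id
      α-natural : ∀ {A B C D E F} (f : A ⇒ B) (g : C ⇒ D) (h : E ⇒ F) →
                  α⇒ ∘ ((f ⊗₁ g) ⊗₁ h) ≈ (f ⊗₁ (g ⊗₁ h)) ∘ α⇒
      triangle : ∀ {A B} → (id {A} ⊗₁ λ⇒ {B}) ∘ α⇒ ≈ ρ⇒ ⊗₁ id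
      pentagon : ∀ {A B C D} →
                 (id {A} ⊗₁ α⇒ {B} {C} {D}) ∘ α⇒ ∘ (α⇒ ⊗₁ id) ≈ α⇒ ∘ α⇒

  module _ (M : Monoidal) where
    open Monoidal M

    record Symmetric : Set (o ⊔ ℓ ⊔ e) where
      field
        σ : ∀ {A B} → (A ⊗₀ B) ⇒ (B ⊗₀ A)
        σ-natural : ∀ {A B C D} (f : A ⇒ B) (g : C ⇒ D) →
                    σ ∘ (f ⊗₁ g) ≈ (g ⊗₁ f) ∘ σ
        σ-involutive : ∀ {A B} → σ {B} {A} ∘ σ {A} {B} ≈ id
        hexagon : ∀ {A B C} →
                  α⇒ {B} {C} {A} ∘ σ {A} {B ⊗₀ C} ∘ α⇒
                  ≈ (id ⊗₁ σ {A} {C}) ∘ α⇒ ∘ (σ {A} {B} ⊗₁ id)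

    record Closed : Set (o ⊔ ℓ ⊔ e) where
      field
        [_,_] : Obj → Obj → Obj
        eval  : ∀ {B D} → ([ B , D ] ⊗₀ B) ⇒ D
        curry : ∀ {A B D} → (A ⊗₀ B) ⇒ D → A ⇒ [ B , D ]
        eval-curry : ∀ {A B D} (f : (A ⊗₀ B) ⇒ D) → eval ∘ (curry f ⊗₁ id) ≈ f
        curry-unique : ∀ {A B D} (f : (A ⊗₀ B) ⇒ D) (g : A ⇒ [ B , D ]) →
                       eval ∘ (g ⊗₁ id) ≈ f → g ≈ curry f

    record RawMonoidObj : Set (o ⊔ ℓ) where
      field
        Carrier : Obj
        μ : (Carrier ⊗₀ Carrier) ⇒ Carrier
        η : unit ⇒ Carrier

    record IsMonoidObj (R : RawMonoidObj) : Set e where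
      open RawMonoidObj R
      field
        μ-assoc : μ ∘ (μ ⊗₁ id) ≈ μ ∘ (id ⊗₁ μ) ∘ α⇒
        μ-identityˡ : μ ∘ (η ⊗₁ id) ≈ λ⇒
        μ-identityʳ : μ ∘ (id ⊗₁ η) ≈ ρ⇒

    record MonoidObj : Set (o ⊔ ℓ ⊔ e) where
      field
        raw : RawMonoidObj
        isMonoid : IsMonoidObj raw
      open RawMonoidObj raw public

    record IsMonoidHom (R S : RawMonoidObj)
                       (h : RawMonoidObj.Carrier R ⇒ RawMonoidObj.Carrier S)
                       : Set e where
      field
        preserves-μ : h ∘ RawMonoidObj.μ R ≈ RawMonoidObj.μ S ∘ (h ⊗₁ h)
        preserves-η : h ∘ RawMonoidObj.η R ≈ RawMonoidObj.η S

    module FreeMonoid (S : Symmetric) (Cl : Closed)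
                      (CP : CountableCoproducts C) (X : Obj) where
      open Symmetric S
      open Closed Cl

      pow : ℕ → Obj
      pow zero    = unit
      pow (suc n) = pow n ⊗₀ X

      concat : ∀ m n → (pow m ⊗₀ pow n) ⇒ pow (n + m)
      concat m zero    = ρ⇒
      concat m (suc n) = (concat m n ⊗₁ id) ∘ α⇐

      coprod : Coproduct C pow
      coprod = CP ℕ (↣-id ℕ) pow

      open Coproduct coprod

      X* : Obj
      X* = ∐

      k : ∀ m n → (pow m ⊗₀ pow n) ⇒ X*
      k m n = ι (n + m) ∘ concat m n

      -- h m : X^{⊗m} ⊗ X* → X*   (using that X^{⊗m} ⊗ - ≅ - ⊗ X^{⊗m} preserves
      -- coproducts, as a left adjoint)
      h : ∀ m → (pow m ⊗₀ X*) ⇒ X*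
      h m = eval ∘ (copair (λ n → curry (k m n ∘ σ)) ⊗₁ id) ∘ σ

      μ* : (X* ⊗₀ X*) ⇒ X*
      μ* = eval ∘ (copair (λ m → curry (h m)) ⊗₁ id)

      η* : unit ⇒ X*
      η* = ι zero

      X*-raw : RawMonoidObj
      X*-raw = record { Carrier = X* ; μ = μ* ; η = η* }

      module _ {p : Level} (E : MorphClass C p) {Y : Obj} (L : X* ⇒ Y) where

        Recognizes : (N : MonoidObj) → X* ⇒ MonoidObj.Carrier N → Set (ℓ ⊔ e)
        Recognizes N e' = Σ (MonoidObj.Carrier N ⇒ Y) λ f → L ≈ f ∘ e'

        _≤_ : {N₁ N₂ : MonoidObj} → X* ⇒ MonoidObj.Carrier N₁ →
              X* ⇒ MonoidObj.Carrier N₂ → Set (ℓ ⊔ e)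
        _≤_ {N₁} {N₂} e₁ e₂ =
          Σ (MonoidObj.Carrier N₂ ⇒ MonoidObj.Carrier N₁) λ g →
            IsMonoidHom (MonoidObj.raw N₂) (MonoidObj.raw N₁) g × (e₁ ≈ g ∘ e₂)

        record SyntacticMonoid : Set (o ⊔ ℓ ⊔ e ⊔ p) where
          field
            Syn : MonoidObj
            eL  : X* ⇒ MonoidObj.Carrier Syn
            -- e_L is an X-generated D-monoid
            eL-hom : IsMonoidHom X*-raw (MonoidObj.raw Syn) eL
            eL-E   : E eL
            eL-recognizes : Recognizes Syn eL
            eL-minimal : (N : MonoidObj) (e' : X* ⇒ MonoidObj.Carrier N) →
                         IsMonoidHom X*-raw (MonoidObj.raw N) e' → E e' →
                         Recognizes N e' → _≤_ {Syn} {N} eL e'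

module _ {o ℓ e : Level} (C : Category o ℓ e) where
  open Category C

  RespectsEq : ∀ {p} → MorphClass C p → Set (o ⊔ ℓ ⊔ e ⊔ p)
  RespectsEq E = ∀ {A B} {f g : A ⇒ B} → f ≈ g → E f → E g

  ConsistsOfEpis : ∀ {p} → MorphClass C p → Set (o ⊔ ℓ ⊔ e ⊔ p)
  ConsistsOfEpis E = ∀ {A B} (f : A ⇒ B) → E f → IsEpi C f

  ContainsIsos : ∀ {p} → MorphClass C p → Set (o ⊔ ℓ ⊔ e ⊔ p)
  ContainsIsos E = ∀ {A B} (f : A ⇒ B) → IsIso C f → E f

  ClosedUnderComposition : ∀ {p} → MorphClass C p → Set (o ⊔ ℓ ⊔ p)
  ClosedUnderComposition E = ∀ {A B D} (f : A ⇒ B) (g : B ⇒ D) → E f → E g → E (g ∘ f)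

  -- wide pushouts are indexed by families of size o ⊔ ℓ ⊔ e ⊔ p
  -- (i.e. by all "small" sets relative to the category and the class 𝓔)
  HasWidePushoutsOf : ∀ {p} → MorphClass C p → Set (lsuc (o ⊔ ℓ ⊔ e ⊔ p))
  HasWidePushoutsOf {p} E =
    (I : Set (o ⊔ ℓ ⊔ e ⊔ p)) {A : Obj} {B : I → Obj} (f : ∀ i → A ⇒ B i) →
    (∀ i → E (f i)) → WidePushout C f

  ClosedUnderWidePushouts : ∀ {p} → MorphClass C p → Set (lsuc (o ⊔ ℓ ⊔ e ⊔ p))
  ClosedUnderWidePushouts {p} E =
    (I : Set (o ⊔ ℓ ⊔ e ⊔ p)) {A : Obj} {B : I → Obj} (f : ∀ i → A ⇒ B i) →
    (∀ i → E (f i)) → (W : WidePushout C f) → ∀ i → E (WidePushout.inj W i)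

  module _ (M : Monoidal C) where
    open Monoidal M

    ClosedUnderTensor : ∀ {p} → MorphClass C p → Set (o ⊔ ℓ ⊔ p)
    ClosedUnderTensor E =
      ∀ {A A' B B'} (a : A ⇒ A') (b : B ⇒ B') → E a → E b → E (a ⊗₁ b)

    Stable : ∀ {p} → MorphClass C p → Set (o ⊔ ℓ ⊔ e ⊔ p)
    Stable E =
      ∀ {A A' B B'} (a : A ⇒ A') (b : B ⇒ B') → E a → E b →
      IsPushout C (a ⊗₁ id {B}) (id {A} ⊗₁ b) (id {A'} ⊗₁ b) (a ⊗₁ id {B'})

module Submission where

-- Following the paper, it is obtained as the wide pushout P of
-- ALL 𝓔-quotients  q : X* ↠ N  that are D-monoid morphisms recognizing L; the
-- leg p₀ : X* → P lies in 𝓔, and every q factors through it as p₀ = inj ∘ q.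

open import Defs
open import Level using (Level; _⊔_)
open import Data.Nat using (zero; suc; _+_)
open import Data.Nat.Properties using (+-assoc; +-identityʳ; ≡-irrelevant)
open import Data.Product using (Σ; _×_; _,_; proj₁; proj₂)
open import Data.Unit.Polymorphic using (⊤; tt)
open import Relation.Binary.Bundles using (Setoid)
open import Relation.Binary.PropositionalEquality using (_≡_; refl; cong)
import Relation.Binary.PropositionalEquality as ≡
import Relation.Binary.Reasoning.Setoid as SetoidReasoning

module HomReasoning {o ℓ e : Level} (C : Category o ℓ e) where
  open Category C public

  hom-setoid : Obj → Obj → Setoid ℓ e
  hom-setoid A B = record { Carrier = A ⇒ B ; _≈_ = _≈_ ; isEquivalence = equiv }

  module HomSetoid {A B : Obj} = Setoid (hom-setoid A B)
  open HomSetoid public using () renaming (refl to ≈-refl; sym to ≈-sym; trans to ≈-trans)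
  module HomChain {A B : Obj} = SetoidReasoning (hom-setoid A B)
  open HomChain public using (begin_; _∎; step-≈-⟩; step-≈-⟨)

  ∘-congˡ : ∀ {A B D} {h : B ⇒ D} {f g : A ⇒ B} → f ≈ g → h ∘ f ≈ h ∘ g
  ∘-congˡ p = ∘-resp-≈ ≈-refl p

  ∘-congʳ : ∀ {A B D} {h : A ⇒ B} {f g : B ⇒ D} → f ≈ g → f ∘ h ≈ g ∘ h
  ∘-congʳ p = ∘-resp-≈ p ≈-refl

  sym-assoc : ∀ {A B D F} {f : A ⇒ B} {g : B ⇒ D} {h : D ⇒ F} →
              h ∘ (g ∘ f) ≈ (h ∘ g) ∘ f
  sym-assoc = ≈-sym assoc

  pullˡ : ∀ {A B D F} {a : D ⇒ F} {b : B ⇒ D} {c : B ⇒ F} {f : A ⇒ B} →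
          a ∘ b ≈ c → a ∘ (b ∘ f) ≈ c ∘ f
  pullˡ p = ≈-trans sym-assoc (∘-congʳ p)

  pullʳ : ∀ {A B D F} {a : B ⇒ D} {b : A ⇒ B} {c : A ⇒ D} {f : D ⇒ F} →
          a ∘ b ≈ c → (f ∘ a) ∘ b ≈ f ∘ c
  pullʳ p = ≈-trans assoc (∘-congˡ p)

  cancelInner : ∀ {A B D} {a : A ⇒ B} {a' : B ⇒ A} {f : B ⇒ D} →
                a ∘ a' ≈ id → (f ∘ a) ∘ a' ≈ f
  cancelInner inv = ≈-trans (pullʳ inv) identityʳ

  cancelˡ : ∀ {A B D} {a : B ⇒ D} {a' : D ⇒ B} {f g : A ⇒ B} →
            a' ∘ a ≈ id → a ∘ f ≈ a ∘ g → f ≈ g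
  cancelˡ {a = a} {a'} {f} {g} inv p = begin
    f              ≈⟨ identityˡ ⟨
    id ∘ f         ≈⟨ pullˡ inv ⟨
    a' ∘ (a ∘ f)   ≈⟨ ∘-congˡ p ⟩
    a' ∘ (a ∘ g)   ≈⟨ pullˡ inv ⟩
    id ∘ g         ≈⟨ identityˡ ⟩
    g              ∎

  cancelʳ : ∀ {A B D} {a : A ⇒ B} {a' : B ⇒ A} {f g : B ⇒ D} →
            a ∘ a' ≈ id → f ∘ a ≈ g ∘ a → f ≈ g
  cancelʳ {a = a} {a'} {f} {g} inv p = begin
    f              ≈⟨ cancelInner inv ⟨
    (f ∘ a) ∘ a'   ≈⟨ ∘-congʳ p ⟩
    (g ∘ a) ∘ a'   ≈⟨ cancelInner inv ⟩
    g              ∎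

  JointlyEpic : ∀ {K : Set} {S : K → Obj} {T : Obj} (u : ∀ k → S k ⇒ T) → Set (o ⊔ ℓ ⊔ e)
  JointlyEpic {T = T} u = ∀ {Z} (f g : T ⇒ Z) → (∀ k → f ∘ u k ≈ g ∘ u k) → f ≈ g

  id-jointlyEpic : ∀ {T} → JointlyEpic {K = ⊤} {S = λ _ → T} (λ _ → id)
  id-jointlyEpic f g agree = ≈-trans (≈-sym identityʳ) (≈-trans (agree tt) identityʳ)

module MonoidalReasoning {o ℓ e : Level} (C : Category o ℓ e) (M : Monoidal C) where
  open HomReasoning C
  open Monoidal M

  ⊗-compose : ∀ {A B D A' B' D'} {f : B ⇒ D} {g : A ⇒ B} {h : B' ⇒ D'} {k : A' ⇒ B'} →
              (f ⊗₁ h) ∘ (g ⊗₁ k) ≈ (f ∘ g) ⊗₁ (h ∘ k)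
  ⊗-compose = ≈-sym ⊗-homomorphism

  ⊗-congˡ : ∀ {A B D F} {h : D ⇒ F} {f g : A ⇒ B} → f ≈ g → h ⊗₁ f ≈ h ⊗₁ g
  ⊗-congˡ p = ⊗-resp-≈ ≈-refl p

  ⊗-congʳ : ∀ {A B D F} {h : D ⇒ F} {f g : A ⇒ B} → f ≈ g → f ⊗₁ h ≈ g ⊗₁ h
  ⊗-congʳ p = ⊗-resp-≈ p ≈-refl

  ⊗-splitˡ : ∀ {A B D F} {f : A ⇒ B} {g : D ⇒ F} → (f ⊗₁ id) ∘ (id ⊗₁ g) ≈ f ⊗₁ g
  ⊗-splitˡ = ≈-trans ⊗-compose (⊗-resp-≈ identityʳ identityˡ)

  ⊗-splitʳ : ∀ {A B D F} {f : A ⇒ B} {g : D ⇒ F} → (id ⊗₁ g) ∘ (f ⊗₁ id) ≈ f ⊗₁ g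
  ⊗-splitʳ = ≈-trans ⊗-compose (⊗-resp-≈ identityˡ identityʳ)

  ⊗-interchange : ∀ {A B D F} {f : A ⇒ B} {g : D ⇒ F} →
                  (f ⊗₁ id) ∘ (id ⊗₁ g) ≈ (id ⊗₁ g) ∘ (f ⊗₁ id)
  ⊗-interchange = ≈-trans ⊗-splitˡ (≈-sym ⊗-splitʳ)

  ∘-⊗ˡ : ∀ {A B D F G} {x : B ⇒ D} {y : A ⇒ B} {z : F ⇒ G} →
         (x ∘ y) ⊗₁ z ≈ (x ⊗₁ z) ∘ (y ⊗₁ id)
  ∘-⊗ˡ = ≈-trans (⊗-congˡ (≈-sym identityʳ)) ⊗-homomorphism

  ∘-⊗ʳ : ∀ {A B D F G} {x : B ⇒ D} {y : A ⇒ B} {z : F ⇒ G} →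
         z ⊗₁ (x ∘ y) ≈ (z ⊗₁ x) ∘ (id ⊗₁ y)
  ∘-⊗ʳ = ≈-trans (⊗-congʳ (≈-sym identityʳ)) ⊗-homomorphism

  iso-⊗ˡ : ∀ {A B F} {a : A ⇒ B} {a' : B ⇒ A} → a ∘ a' ≈ id → (a ⊗₁ id {F}) ∘ (a' ⊗₁ id) ≈ id
  iso-⊗ˡ inv = ≈-trans ⊗-compose (≈-trans (⊗-resp-≈ inv identityˡ) ⊗-identity)

  iso-⊗ʳ : ∀ {A B F} {a : A ⇒ B} {a' : B ⇒ A} → a ∘ a' ≈ id → (id {F} ⊗₁ a) ∘ (id ⊗₁ a') ≈ id
  iso-⊗ʳ inv = ≈-trans ⊗-compose (≈-trans (⊗-resp-≈ identityˡ inv) ⊗-identity)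

  α⇐-natural : ∀ {A B D F G H} (f : A ⇒ B) (g : D ⇒ F) (h : G ⇒ H) →
               α⇐ ∘ (f ⊗₁ (g ⊗₁ h)) ≈ ((f ⊗₁ g) ⊗₁ h) ∘ α⇐
  α⇐-natural f g h = cancelˡ α-isoˡ (begin
    α⇒ ∘ (α⇐ ∘ (f ⊗₁ (g ⊗₁ h)))   ≈⟨ pullˡ α-isoʳ ⟩
    id ∘ (f ⊗₁ (g ⊗₁ h))          ≈⟨ identityˡ ⟩
    f ⊗₁ (g ⊗₁ h)                 ≈⟨ cancelInner α-isoʳ ⟨
    ((f ⊗₁ (g ⊗₁ h)) ∘ α⇒) ∘ α⇐   ≈⟨ ∘-congʳ (α-natural f g h) ⟨
    (α⇒ ∘ ((f ⊗₁ g) ⊗₁ h)) ∘ α⇐   ≈⟨ assoc ⟩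
    α⇒ ∘ (((f ⊗₁ g) ⊗₁ h) ∘ α⇐)   ∎)

  -- I ⊗ − and − ⊗ I are faithful, being isomorphic to the identity functor
  λ-faithful : ∀ {A B} {f g : A ⇒ B} → id {unit} ⊗₁ f ≈ id ⊗₁ g → f ≈ g
  λ-faithful {f = f} {g} p = cancelʳ λ-isoʳ (begin
    f ∘ λ⇒              ≈⟨ λ-natural f ⟩
    λ⇒ ∘ (id ⊗₁ f)      ≈⟨ ∘-congˡ p ⟩
    λ⇒ ∘ (id ⊗₁ g)      ≈⟨ λ-natural g ⟨
    g ∘ λ⇒              ∎)

  ρ-faithful : ∀ {A B} {f g : A ⇒ B} → f ⊗₁ id {unit} ≈ g ⊗₁ id → f ≈ g
  ρ-faithful {f = f} {g} p = cancelʳ ρ-isoʳ (begin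
    f ∘ ρ⇒              ≈⟨ ρ-natural f ⟩
    ρ⇒ ∘ (f ⊗₁ id)      ≈⟨ ∘-congˡ p ⟩
    ρ⇒ ∘ (g ⊗₁ id)      ≈⟨ ρ-natural g ⟨
    g ∘ ρ⇒              ∎)

  kelly-λ : ∀ {A B} → λ⇒ {A ⊗₀ B} ∘ α⇒ {unit} {A} {B} ≈ λ⇒ ⊗₁ id
  kelly-λ {A} {B} = λ-faithful (cancelʳ α-isoʳ (cancelʳ (iso-⊗ˡ α-isoʳ) (begin
    ((id ⊗₁ (λ⇒ ∘ α⇒)) ∘ α⇒) ∘ (α⇒ ⊗₁ id)              ≈⟨ assoc ⟩
    (id ⊗₁ (λ⇒ ∘ α⇒)) ∘ (α⇒ ∘ (α⇒ ⊗₁ id))              ≈⟨ ∘-congʳ ∘-⊗ʳ ⟩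
    ((id ⊗₁ λ⇒) ∘ (id ⊗₁ α⇒)) ∘ (α⇒ ∘ (α⇒ ⊗₁ id))      ≈⟨ assoc ⟩
    (id ⊗₁ λ⇒) ∘ ((id ⊗₁ α⇒) ∘ (α⇒ ∘ (α⇒ ⊗₁ id)))      ≈⟨ ∘-congˡ pentagon ⟩
    (id ⊗₁ λ⇒) ∘ (α⇒ ∘ α⇒)                             ≈⟨ pullˡ triangle ⟩
    (ρ⇒ ⊗₁ id) ∘ α⇒                                    ≈⟨ ∘-congʳ (⊗-congˡ ⊗-identity) ⟨
    (ρ⇒ ⊗₁ (id ⊗₁ id)) ∘ α⇒                            ≈⟨ α-natural ρ⇒ id id ⟨
    α⇒ ∘ ((ρ⇒ ⊗₁ id) ⊗₁ id)                            ≈⟨ ∘-congˡ (⊗-congʳ triangle) ⟨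
    α⇒ ∘ (((id ⊗₁ λ⇒) ∘ α⇒) ⊗₁ id)                     ≈⟨ ∘-congˡ ∘-⊗ˡ ⟩
    α⇒ ∘ (((id ⊗₁ λ⇒) ⊗₁ id) ∘ (α⇒ ⊗₁ id))             ≈⟨ sym-assoc ⟩
    (α⇒ ∘ ((id ⊗₁ λ⇒) ⊗₁ id)) ∘ (α⇒ ⊗₁ id)             ≈⟨ ∘-congʳ (α-natural id λ⇒ id) ⟩
    ((id ⊗₁ (λ⇒ ⊗₁ id)) ∘ α⇒) ∘ (α⇒ ⊗₁ id)             ∎)))

  kelly-ρ : ∀ {A B} → (id {A} ⊗₁ ρ⇒ {B}) ∘ α⇒ {A} {B} {unit} ≈ ρ⇒
  kelly-ρ {A} {B} = ρ-faithful (cancelˡ α-isoˡ (begin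
    α⇒ ∘ (((id ⊗₁ ρ⇒) ∘ α⇒) ⊗₁ id)                         ≈⟨ ∘-congˡ ∘-⊗ˡ ⟩
    α⇒ ∘ (((id ⊗₁ ρ⇒) ⊗₁ id) ∘ (α⇒ ⊗₁ id))                 ≈⟨ sym-assoc ⟩
    (α⇒ ∘ ((id ⊗₁ ρ⇒) ⊗₁ id)) ∘ (α⇒ ⊗₁ id)                 ≈⟨ ∘-congʳ (α-natural id ρ⇒ id) ⟩
    ((id ⊗₁ (ρ⇒ ⊗₁ id)) ∘ α⇒) ∘ (α⇒ ⊗₁ id)                 ≈⟨ ∘-congʳ (∘-congʳ (⊗-congˡ triangle)) ⟨
    ((id ⊗₁ ((id ⊗₁ λ⇒) ∘ α⇒)) ∘ α⇒) ∘ (α⇒ ⊗₁ id)          ≈⟨ ∘-congʳ (∘-congʳ ∘-⊗ʳ) ⟩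
    (((id ⊗₁ (id ⊗₁ λ⇒)) ∘ (id ⊗₁ α⇒)) ∘ α⇒) ∘ (α⇒ ⊗₁ id)  ≈⟨ ≈-trans assoc assoc ⟩
    (id ⊗₁ (id ⊗₁ λ⇒)) ∘ ((id ⊗₁ α⇒) ∘ (α⇒ ∘ (α⇒ ⊗₁ id)))  ≈⟨ ∘-congˡ pentagon ⟩
    (id ⊗₁ (id ⊗₁ λ⇒)) ∘ (α⇒ ∘ α⇒)                         ≈⟨ sym-assoc ⟩
    ((id ⊗₁ (id ⊗₁ λ⇒)) ∘ α⇒) ∘ α⇒                         ≈⟨ ∘-congʳ (α-natural id id λ⇒) ⟨
    (α⇒ ∘ ((id ⊗₁ id) ⊗₁ λ⇒)) ∘ α⇒                         ≈⟨ ∘-congʳ (∘-congˡ (⊗-congʳ ⊗-identity)) ⟩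
    (α⇒ ∘ (id ⊗₁ λ⇒)) ∘ α⇒                                 ≈⟨ pullʳ triangle ⟩
    α⇒ ∘ (ρ⇒ ⊗₁ id)                                        ∎))

  λ-unit-ρ : λ⇒ {unit} ≈ ρ⇒
  λ-unit-ρ = ρ-faithful (begin
    λ⇒ ⊗₁ id          ≈⟨ kelly-λ ⟨
    λ⇒ ∘ α⇒           ≈⟨ ∘-congʳ λ-on-I⊗I ⟩
    (id ⊗₁ λ⇒) ∘ α⇒   ≈⟨ triangle ⟩
    ρ⇒ ⊗₁ id          ∎)
    where
    λ-on-I⊗I : λ⇒ {unit ⊗₀ unit} ≈ id ⊗₁ λ⇒
    λ-on-I⊗I = cancelˡ λ-isoˡ (λ-natural λ⇒)

  -- the pentagon, solved for  (α ⊗ F) ∘ α⁻¹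
  pentagon⁻¹ : ∀ {A B D F} → (α⇒ {A} {B} {D} ⊗₁ id {F}) ∘ α⇐ ≈ α⇐ ∘ (id ⊗₁ α⇐) ∘ α⇒
  pentagon⁻¹ = cancelˡ α-isoˡ (cancelˡ (iso-⊗ʳ α-isoˡ) (begin
    (id ⊗₁ α⇒) ∘ (α⇒ ∘ ((α⇒ ⊗₁ id) ∘ α⇐))            ≈⟨ ≈-trans (∘-congˡ sym-assoc) sym-assoc ⟩
    ((id ⊗₁ α⇒) ∘ (α⇒ ∘ (α⇒ ⊗₁ id))) ∘ α⇐            ≈⟨ ∘-congʳ pentagon ⟩
    (α⇒ ∘ α⇒) ∘ α⇐                                   ≈⟨ cancelInner α-isoʳ ⟩
    α⇒                                               ≈⟨ identityˡ ⟨
    id ∘ α⇒                                          ≈⟨ ∘-congʳ (iso-⊗ʳ α-isoʳ) ⟨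
    ((id ⊗₁ α⇒) ∘ (id ⊗₁ α⇐)) ∘ α⇒                   ≈⟨ assoc ⟩
    (id ⊗₁ α⇒) ∘ ((id ⊗₁ α⇐) ∘ α⇒)                   ≈⟨ ∘-congˡ (≈-trans (pullˡ α-isoʳ) identityˡ) ⟨
    (id ⊗₁ α⇒) ∘ (α⇒ ∘ (α⇐ ∘ ((id ⊗₁ α⇐) ∘ α⇒)))     ∎))

  α⇐-absorb : ∀ {A B D G H} {F : (B ⊗₀ D) ⇒ G} {g : A ⇒ B} →
              ((F ⊗₁ id {H}) ∘ α⇐) ∘ (g ⊗₁ id) ≈ ((F ∘ (g ⊗₁ id)) ⊗₁ id) ∘ α⇐
  α⇐-absorb {F = F} {g} = begin
    ((F ⊗₁ id) ∘ α⇐) ∘ (g ⊗₁ id)             ≈⟨ pullʳ (∘-congˡ (⊗-congˡ (≈-sym ⊗-identity))) ⟩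
    (F ⊗₁ id) ∘ (α⇐ ∘ (g ⊗₁ (id ⊗₁ id)))     ≈⟨ ∘-congˡ (α⇐-natural g id id) ⟩
    (F ⊗₁ id) ∘ (((g ⊗₁ id) ⊗₁ id) ∘ α⇐)     ≈⟨ sym-assoc ⟩
    ((F ⊗₁ id) ∘ ((g ⊗₁ id) ⊗₁ id)) ∘ α⇐     ≈⟨ ∘-congʳ ∘-⊗ˡ ⟨
    ((F ∘ (g ⊗₁ id)) ⊗₁ id) ∘ α⇐             ∎

  rebracket : ∀ {A B B' D G H} {K : (A ⊗₀ B') ⇒ G} {g : (B ⊗₀ D) ⇒ B'} →
              ((K ∘ ((id ⊗₁ g) ∘ α⇒)) ⊗₁ id {H}) ∘ α⇐
              ≈ ((K ⊗₁ id) ∘ α⇐) ∘ ((id ⊗₁ ((g ⊗₁ id) ∘ α⇐)) ∘ α⇒)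
  rebracket {K = K} {g} = begin
    ((K ∘ ((id ⊗₁ g) ∘ α⇒)) ⊗₁ id) ∘ α⇐                      ≈⟨ ∘-congʳ (≈-trans ∘-⊗ˡ (∘-congˡ ∘-⊗ˡ)) ⟩
    ((K ⊗₁ id) ∘ (((id ⊗₁ g) ⊗₁ id) ∘ (α⇒ ⊗₁ id))) ∘ α⇐      ≈⟨ ≈-trans assoc (∘-congˡ assoc) ⟩
    (K ⊗₁ id) ∘ (((id ⊗₁ g) ⊗₁ id) ∘ ((α⇒ ⊗₁ id) ∘ α⇐))      ≈⟨ ∘-congˡ (∘-congˡ pentagon⁻¹) ⟩
    (K ⊗₁ id) ∘ (((id ⊗₁ g) ⊗₁ id) ∘ (α⇐ ∘ ((id ⊗₁ α⇐) ∘ α⇒)))  ≈⟨ ∘-congˡ sym-assoc ⟩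
    (K ⊗₁ id) ∘ ((((id ⊗₁ g) ⊗₁ id) ∘ α⇐) ∘ ((id ⊗₁ α⇐) ∘ α⇒))  ≈⟨ ∘-congˡ (∘-congʳ (α⇐-natural id g id)) ⟨
    (K ⊗₁ id) ∘ ((α⇐ ∘ (id ⊗₁ (g ⊗₁ id))) ∘ ((id ⊗₁ α⇐) ∘ α⇒))  ≈⟨ ∘-congˡ (≈-trans assoc (∘-congˡ sym-assoc)) ⟩
    (K ⊗₁ id) ∘ (α⇐ ∘ (((id ⊗₁ (g ⊗₁ id)) ∘ (id ⊗₁ α⇐)) ∘ α⇒))  ≈⟨ ∘-congˡ (∘-congˡ (∘-congʳ ∘-⊗ʳ)) ⟨
    (K ⊗₁ id) ∘ (α⇐ ∘ ((id ⊗₁ ((g ⊗₁ id) ∘ α⇐)) ∘ α⇒))          ≈⟨ sym-assoc ⟩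
    ((K ⊗₁ id) ∘ α⇐) ∘ ((id ⊗₁ ((g ⊗₁ id) ∘ α⇐)) ∘ α⇒)          ∎

-- In a symmetric monoidal closed category, − ⊗ B ⊣ [B , −].  Maps out of a
-- tensor are determined by their curried transposes; consequently tensors of
-- jointly epic families are jointly epic.
module ClosedReasoning {o ℓ e : Level} (C : Category o ℓ e) (M : Monoidal C)
                       (S : Symmetric C M) (Cl : Closed C M) where
  open HomReasoning C
  open Monoidal M
  open MonoidalReasoning C M
  open Symmetric S
  open Closed Cl

  curry-cong : ∀ {A B D} {f g : (A ⊗₀ B) ⇒ D} → f ≈ g → curry f ≈ curry g
  curry-cong {f = f} {g} p = curry-unique g (curry f) (≈-trans (eval-curry f) p)

  curry-natural : ∀ {A A' B D} (f : (A ⊗₀ B) ⇒ D) (a : A' ⇒ A) →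
                  curry f ∘ a ≈ curry (f ∘ (a ⊗₁ id))
  curry-natural f a = curry-unique (f ∘ (a ⊗₁ id)) (curry f ∘ a) (begin
    eval ∘ ((curry f ∘ a) ⊗₁ id)            ≈⟨ ∘-congˡ ∘-⊗ˡ ⟩
    eval ∘ ((curry f ⊗₁ id) ∘ (a ⊗₁ id))    ≈⟨ pullˡ (eval-curry f) ⟩
    f ∘ (a ⊗₁ id)                           ∎)

  curry-injective : ∀ {A B D} {f g : (A ⊗₀ B) ⇒ D} → curry f ≈ curry g → f ≈ g
  curry-injective {f = f} {g} p = begin
    f                         ≈⟨ eval-curry f ⟨
    eval ∘ (curry f ⊗₁ id)    ≈⟨ ∘-congˡ (⊗-congʳ p) ⟩
    eval ∘ (curry g ⊗₁ id)    ≈⟨ eval-curry g ⟩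
    g                         ∎

  -- − ⊗ B preserves joint epicness: f ∘ (u ⊗ B) is determined by its transpose
  jointlyEpic-⊗ˡ : ∀ {K : Set} {S : K → Obj} {A B} {u : ∀ k → S k ⇒ A} → JointlyEpic u →
                   ∀ {Z} (f g : (A ⊗₀ B) ⇒ Z) →
                   (∀ k → f ∘ (u k ⊗₁ id) ≈ g ∘ (u k ⊗₁ id)) → f ≈ g
  jointlyEpic-⊗ˡ {u = u} epic f g agree = curry-injective (epic (curry f) (curry g) λ k → begin
    curry f ∘ u k                ≈⟨ curry-natural f (u k) ⟩
    curry (f ∘ (u k ⊗₁ id))      ≈⟨ curry-cong (agree k) ⟩
    curry (g ∘ (u k ⊗₁ id))      ≈⟨ curry-natural g (u k) ⟨
    curry g ∘ u k                ∎)

  -- the symmetry is its own inverse, hence epic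
  σ-cancel : ∀ {A B D} {f g : (A ⊗₀ B) ⇒ D} → f ∘ σ ≈ g ∘ σ → f ≈ g
  σ-cancel = cancelʳ σ-involutive

  jointlyEpic-⊗ : ∀ {K₁ K₂ : Set} {S₁ : K₁ → Obj} {S₂ : K₂ → Obj} {A B}
                  {u : ∀ k → S₁ k ⇒ A} {v : ∀ k → S₂ k ⇒ B} →
                  JointlyEpic u → JointlyEpic v →
                  JointlyEpic {K = K₁ × K₂} (λ k → u (proj₁ k) ⊗₁ v (proj₂ k))
  jointlyEpic-⊗ {u = u} {v} epic-u epic-v f g agree =
    jointlyEpic-⊗ˡ epic-u f g λ k₁ → σ-cancel
      (jointlyEpic-⊗ˡ epic-v _ _ λ k₂ → begin
        ((f ∘ (u k₁ ⊗₁ id)) ∘ σ) ∘ (v k₂ ⊗₁ id)   ≈⟨ swapped f k₁ k₂ ⟩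
        (f ∘ (u k₁ ⊗₁ v k₂)) ∘ σ                  ≈⟨ ∘-congʳ (agree (k₁ , k₂)) ⟩
        (g ∘ (u k₁ ⊗₁ v k₂)) ∘ σ                  ≈⟨ swapped g k₁ k₂ ⟨
        ((g ∘ (u k₁ ⊗₁ id)) ∘ σ) ∘ (v k₂ ⊗₁ id)   ∎)
    where
    swapped : ∀ {Z} (h : _ ⇒ Z) k₁ k₂ →
              ((h ∘ (u k₁ ⊗₁ id)) ∘ σ) ∘ (v k₂ ⊗₁ id) ≈ (h ∘ (u k₁ ⊗₁ v k₂)) ∘ σ
    swapped h k₁ k₂ = begin
      ((h ∘ (u k₁ ⊗₁ id)) ∘ σ) ∘ (v k₂ ⊗₁ id)   ≈⟨ pullʳ (σ-natural _ _) ⟩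
      (h ∘ (u k₁ ⊗₁ id)) ∘ ((id ⊗₁ v k₂) ∘ σ)   ≈⟨ ≈-trans assoc (∘-congˡ sym-assoc) ⟩
      h ∘ (((u k₁ ⊗₁ id) ∘ (id ⊗₁ v k₂)) ∘ σ)   ≈⟨ ∘-congˡ (∘-congʳ ⊗-splitˡ) ⟩
      h ∘ ((u k₁ ⊗₁ v k₂) ∘ σ)                  ≈⟨ sym-assoc ⟩
      (h ∘ (u k₁ ⊗₁ v k₂)) ∘ σ                  ∎

-- Each law is an equation of maps out of a tensor of copies of X*, so it
-- suffices to check it on the jointly epic family of tensors of coproduct
-- injections ι m ⊗ ι n (⊗ ι k), where μ* restricts to concatenation; the laws
-- then reduce to associativity and unitality of concatenation, which hold up
-- to transport along the arithmetic identities of ℕ.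
module FreeMonoidLaws {o ℓ e : Level} (C : Category o ℓ e) (M : Monoidal C)
                      (S : Symmetric C M) (Cl : Closed C M)
                      (CP : CountableCoproducts C) (X : Category.Obj C) where
  open HomReasoning C
  open Monoidal M
  open MonoidalReasoning C M
  open Symmetric S
  open Closed Cl
  open ClosedReasoning C M S Cl
  open FreeMonoid C M S Cl CP X
  open Coproduct coprod

  transport : ∀ {m n} → m ≡ n → pow m ⇒ pow n
  transport refl = id

  transport-irrelevant : ∀ {m n} (q q' : m ≡ n) → transport q ≈ transport q'
  transport-irrelevant q q' rewrite ≡-irrelevant q q' = ≈-refl

  transport-suc : ∀ {m n} (q : m ≡ n) → transport (cong suc q) ≈ transport q ⊗₁ id
  transport-suc refl = ≈-sym ⊗-identity

  ι-transport : ∀ {m n} (q : m ≡ n) → ι n ∘ transport q ≈ ι m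
  ι-transport refl = identityʳ

  concat-unitˡ : ∀ n → concat 0 n ≈ transport (≡.sym (+-identityʳ n)) ∘ λ⇒
  concat-unitˡ zero = ≈-trans (≈-sym λ-unit-ρ) (≈-sym identityˡ)
  concat-unitˡ (suc n) = begin
    (concat 0 n ⊗₁ id) ∘ α⇐                      ≈⟨ ∘-congʳ (⊗-congʳ (concat-unitˡ n)) ⟩
    ((transport q ∘ λ⇒) ⊗₁ id) ∘ α⇐              ≈⟨ ≈-trans (∘-congʳ ∘-⊗ˡ) (pullʳ (∘-congʳ (≈-sym kelly-λ))) ⟩
    (transport q ⊗₁ id) ∘ ((λ⇒ ∘ α⇒) ∘ α⇐)       ≈⟨ ∘-congˡ (cancelInner α-isoʳ) ⟩
    (transport q ⊗₁ id) ∘ λ⇒                     ≈⟨ ∘-congʳ (transport-suc q) ⟨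
    transport (cong suc q) ∘ λ⇒                  ≈⟨ ∘-congʳ (transport-irrelevant (cong suc q) (≡.sym (+-identityʳ (suc n)))) ⟩
    transport (≡.sym (+-identityʳ (suc n))) ∘ λ⇒ ∎
    where q = ≡.sym (+-identityʳ n)

  concat-assoc : ∀ a b c →
    concat (b + a) c ∘ (concat a b ⊗₁ id) ≈
    transport (+-assoc c b a) ∘ (concat a (c + b) ∘ ((id ⊗₁ concat b c) ∘ α⇒))
  concat-assoc a b zero = begin
    ρ⇒ ∘ (concat a b ⊗₁ id)                        ≈⟨ ρ-natural _ ⟨
    concat a b ∘ ρ⇒                                ≈⟨ ∘-congˡ kelly-ρ ⟨
    concat a b ∘ ((id ⊗₁ ρ⇒) ∘ α⇒)                 ≈⟨ identityˡ ⟨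
    transport (+-assoc zero b a) ∘ (concat a b ∘ ((id ⊗₁ ρ⇒) ∘ α⇒)) ∎
  concat-assoc a b (suc c) = begin
    ((concat (b + a) c ⊗₁ id) ∘ α⇐) ∘ (concat a b ⊗₁ id)        ≈⟨ α⇐-absorb ⟩
    ((concat (b + a) c ∘ (concat a b ⊗₁ id)) ⊗₁ id) ∘ α⇐        ≈⟨ ∘-congʳ (⊗-congʳ (concat-assoc a b c)) ⟩
    ((transport q ∘ rest) ⊗₁ id) ∘ α⇐                           ≈⟨ ≈-trans (∘-congʳ ∘-⊗ˡ) assoc ⟩
    (transport q ⊗₁ id) ∘ ((rest ⊗₁ id) ∘ α⇐)                   ≈⟨ ∘-congˡ rebracket ⟩
    (transport q ⊗₁ id) ∘ rest'                                  ≈⟨ ∘-congʳ (transport-suc q) ⟨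
    transport (cong suc q) ∘ rest'                               ≈⟨ ∘-congʳ (transport-irrelevant (cong suc q) (+-assoc (suc c) b a)) ⟩
    transport (+-assoc (suc c) b a) ∘ rest'                      ∎
    where
    q = +-assoc c b a
    rest = concat a (c + b) ∘ ((id ⊗₁ concat b c) ∘ α⇒)
    rest' = concat a (suc (c + b)) ∘ ((id ⊗₁ concat b (suc c)) ∘ α⇒)

  μ*-on-summands : ∀ m n → μ* ∘ (ι m ⊗₁ ι n) ≈ ι (n + m) ∘ concat m n
  μ*-on-summands m n = begin
    (eval ∘ (cp ⊗₁ id)) ∘ (ι m ⊗₁ ι n)            ≈⟨ pullʳ (≈-trans ⊗-compose (⊗-resp-≈ (inject _ m) identityˡ)) ⟩
    eval ∘ (curry (h m) ⊗₁ ι n)                   ≈⟨ ∘-congˡ ⊗-splitˡ ⟨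
    eval ∘ ((curry (h m) ⊗₁ id) ∘ (id ⊗₁ ι n))    ≈⟨ pullˡ (eval-curry (h m)) ⟩
    h m ∘ (id ⊗₁ ι n)                             ≈⟨ ≈-trans assoc (∘-congˡ assoc) ⟩
    eval ∘ ((cp' ⊗₁ id) ∘ (σ ∘ (id ⊗₁ ι n)))      ≈⟨ ∘-congˡ (∘-congˡ (σ-natural _ _)) ⟩
    eval ∘ ((cp' ⊗₁ id) ∘ ((ι n ⊗₁ id) ∘ σ))      ≈⟨ ∘-congˡ (pullˡ (≈-trans (≈-sym ∘-⊗ˡ) (⊗-congʳ (inject _ n)))) ⟩
    eval ∘ ((curry (k m n ∘ σ) ⊗₁ id) ∘ σ)        ≈⟨ pullˡ (eval-curry _) ⟩
    (k m n ∘ σ) ∘ σ                               ≈⟨ cancelInner σ-involutive ⟩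
    k m n                                         ∎
    where
    cp = copair (λ m → curry (h m))
    cp' = copair (λ n → curry (k m n ∘ σ))

  ι-jointlyEpic : JointlyEpic ι
  ι-jointlyEpic f g agree =
    ≈-trans (unique (λ n → g ∘ ι n) f agree) (≈-sym (unique (λ n → g ∘ ι n) g (λ _ → ≈-refl)))

  μ*-assoc : μ* ∘ (μ* ⊗₁ id) ≈ μ* ∘ (id ⊗₁ μ*) ∘ α⇒
  μ*-assoc = jointlyEpic-⊗ (jointlyEpic-⊗ ι-jointlyEpic ι-jointlyEpic) ι-jointlyEpic _ _
    λ { ((a , b) , c) → begin
    (μ* ∘ (μ* ⊗₁ id)) ∘ ((ι a ⊗₁ ι b) ⊗₁ ι c)                      ≈⟨ pullʳ ⊗-compose ⟩
    μ* ∘ ((μ* ∘ (ι a ⊗₁ ι b)) ⊗₁ (id ∘ ι c))                       ≈⟨ ∘-congˡ (⊗-resp-≈ (μ*-on-summands a b) identityˡ) ⟩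
    μ* ∘ ((ι (b + a) ∘ concat a b) ⊗₁ ι c)                         ≈⟨ ∘-congˡ ∘-⊗ˡ ⟩
    μ* ∘ ((ι (b + a) ⊗₁ ι c) ∘ (concat a b ⊗₁ id))                 ≈⟨ pullˡ (μ*-on-summands (b + a) c) ⟩
    (ι (c + (b + a)) ∘ concat (b + a) c) ∘ (concat a b ⊗₁ id)      ≈⟨ pullʳ (concat-assoc a b c) ⟩
    ι (c + (b + a)) ∘ (transport (+-assoc c b a) ∘ (concat a (c + b) ∘ ((id ⊗₁ concat b c) ∘ α⇒)))
                                                                   ≈⟨ pullˡ (ι-transport (+-assoc c b a)) ⟩
    ι (c + b + a) ∘ (concat a (c + b) ∘ ((id ⊗₁ concat b c) ∘ α⇒)) ≈⟨ sym-assoc ⟩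
    (ι (c + b + a) ∘ concat a (c + b)) ∘ ((id ⊗₁ concat b c) ∘ α⇒) ≈⟨ ∘-congʳ (μ*-on-summands a (c + b)) ⟨
    (μ* ∘ (ι a ⊗₁ ι (c + b))) ∘ ((id ⊗₁ concat b c) ∘ α⇒)          ≈⟨ ≈-trans assoc (∘-congˡ sym-assoc) ⟩
    μ* ∘ (((ι a ⊗₁ ι (c + b)) ∘ (id ⊗₁ concat b c)) ∘ α⇒)          ≈⟨ ∘-congˡ (∘-congʳ ∘-⊗ʳ) ⟨
    μ* ∘ ((ι a ⊗₁ (ι (c + b) ∘ concat b c)) ∘ α⇒)                  ≈⟨ ∘-congˡ (∘-congʳ (⊗-resp-≈ identityˡ (μ*-on-summands b c))) ⟨
    μ* ∘ (((id ∘ ι a) ⊗₁ (μ* ∘ (ι b ⊗₁ ι c))) ∘ α⇒)                ≈⟨ ∘-congˡ (∘-congʳ ⊗-homomorphism) ⟩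
    μ* ∘ (((id ⊗₁ μ*) ∘ (ι a ⊗₁ (ι b ⊗₁ ι c))) ∘ α⇒)               ≈⟨ ∘-congˡ (pullʳ (≈-sym (α-natural _ _ _))) ⟩
    μ* ∘ ((id ⊗₁ μ*) ∘ (α⇒ ∘ ((ι a ⊗₁ ι b) ⊗₁ ι c)))               ≈⟨ ≈-trans (∘-congˡ sym-assoc) sym-assoc ⟩
    (μ* ∘ (id ⊗₁ μ*) ∘ α⇒) ∘ ((ι a ⊗₁ ι b) ⊗₁ ι c)                 ∎ }

  μ*-identityˡ : μ* ∘ (η* ⊗₁ id) ≈ λ⇒
  μ*-identityˡ = jointlyEpic-⊗ (id-jointlyEpic {unit}) ι-jointlyEpic _ _ λ { (_ , n) → begin
    (μ* ∘ (η* ⊗₁ id)) ∘ (id ⊗₁ ι n)                 ≈⟨ pullʳ ⊗-splitˡ ⟩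
    μ* ∘ (ι 0 ⊗₁ ι n)                               ≈⟨ μ*-on-summands 0 n ⟩
    ι (n + 0) ∘ concat 0 n                          ≈⟨ ∘-congˡ (concat-unitˡ n) ⟩
    ι (n + 0) ∘ (transport (≡.sym (+-identityʳ n)) ∘ λ⇒) ≈⟨ pullˡ (ι-transport (≡.sym (+-identityʳ n))) ⟩
    ι n ∘ λ⇒                                        ≈⟨ λ-natural _ ⟩
    λ⇒ ∘ (id ⊗₁ ι n)                                ∎ }

  μ*-identityʳ : μ* ∘ (id ⊗₁ η*) ≈ ρ⇒
  μ*-identityʳ = jointlyEpic-⊗ ι-jointlyEpic (id-jointlyEpic {unit}) _ _ λ { (m , _) → begin
    (μ* ∘ (id ⊗₁ η*)) ∘ (ι m ⊗₁ id)   ≈⟨ pullʳ ⊗-splitʳ ⟩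
    μ* ∘ (ι m ⊗₁ ι 0)                 ≈⟨ μ*-on-summands m 0 ⟩
    ι m ∘ ρ⇒                          ≈⟨ ρ-natural _ ⟩
    ρ⇒ ∘ (ι m ⊗₁ id)                  ∎ }

  X*-monoid : MonoidObj C M
  X*-monoid = record
    { raw = X*-raw
    ; isMonoid = record
      { μ-assoc = μ*-assoc ; μ-identityˡ = μ*-identityˡ ; μ-identityʳ = μ*-identityʳ } }

-- P is the wide pushout of all recognizers  q : A ↠ N  (𝓔-quotients that are
-- monoid morphisms and through which L factors), with p₀ : A → P the common
-- composite  inj ∘ q.  Because − ⊗ B preserves this wide pushout and the
-- tensor of two 𝓔-quotients is a pushout (stability), the multiplication of A
-- descends along p₀ ⊗ p₀; the monoid laws of P follow since tensors of
-- 𝓔-morphisms are epic.  Finally each inj is a monoid morphism, so p₀ lies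
-- below every recognizer.
module SyntacticQuotient
    {o ℓ e p : Level} (C : Category o ℓ e) (M : Monoidal C) (S : Symmetric C M)
    (Cl : Closed C M) (E : MorphClass C p)
    (E-resp : RespectsEq C E) (E-epi : ConsistsOfEpis C E) (E-iso : ContainsIsos C E)
    (E-stable : Stable C M E) (E-widePushout : ClosedUnderWidePushouts C E)
    (E-⊗ : ClosedUnderTensor C M E) (widePushouts : HasWidePushoutsOf C E)
    (A : MonoidObj C M) {Y : Category.Obj C}
    (L : Category._⇒_ C (MonoidObj.Carrier A) Y) where
  open HomReasoning C
  open Monoidal M
  open MonoidalReasoning C M
  open Symmetric S
  open Closed Cl
  open ClosedReasoning C M S Cl
  open MonoidObj A using (Carrier; μ; η)
  open IsMonoidObj (MonoidObj.isMonoid A)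

  ∣_∣ : MonoidObj C M → Obj
  ∣ N ∣ = MonoidObj.Carrier N

  Recognizes : (N : MonoidObj C M) → Carrier ⇒ ∣ N ∣ → Set (ℓ ⊔ e)
  Recognizes N f = Σ (∣ N ∣ ⇒ Y) λ g → L ≈ g ∘ f

  record Recognizer : Set (o ⊔ ℓ ⊔ e ⊔ p) where
    field
      N : MonoidObj C M
      q : Carrier ⇒ ∣ N ∣
      q-hom : IsMonoidHom C M (MonoidObj.raw A) (MonoidObj.raw N) q
      q-E : E q
      q-recognizes : Recognizes N q
  open Recognizer

  μ[_] : ∀ i → (∣ N i ∣ ⊗₀ ∣ N i ∣) ⇒ ∣ N i ∣
  μ[ i ] = MonoidObj.μ (N i)

  W : WidePushout C q
  W = widePushouts Recognizer q q-E
  open WidePushout W public using (P; p₀)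
  open WidePushout W using (inj; commute; universal)

  E-id : ∀ {B} → E (id {B})
  E-id = E-iso id (id , identityˡ , identityˡ)

  epic : ∀ {B D Z} {f : B ⇒ D} → E f → (g h : D ⇒ Z) → g ∘ f ≈ h ∘ f → g ≈ h
  epic {f = f} f-E = E-epi f f-E

  -- A itself, via the identity, is a recognizer; in particular p₀ ≈ inj of it
  identity-recognizer : Recognizer
  identity-recognizer = record
    { N = A
    ; q = id
    ; q-hom = record
      { preserves-μ = ≈-trans identityˡ (≈-trans (≈-sym identityʳ) (∘-congˡ (≈-sym ⊗-identity)))
      ; preserves-η = identityˡ }
    ; q-E = E-id
    ; q-recognizes = L , ≈-sym identityʳ }

  p₀-E : E p₀
  p₀-E = E-resp (≈-trans (≈-sym identityʳ) (commute identity-recognizer))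
                (E-widePushout Recognizer q q-E W identity-recognizer)

  inj-μ : ∀ i → inj i ∘ (μ[ i ] ∘ (q i ⊗₁ q i)) ≈ p₀ ∘ μ
  inj-μ i = begin
    inj i ∘ (μ[ i ] ∘ (q i ⊗₁ q i))   ≈⟨ ∘-congˡ (IsMonoidHom.preserves-μ (q-hom i)) ⟨
    inj i ∘ (q i ∘ μ)                 ≈⟨ pullˡ (commute i) ⟩
    p₀ ∘ μ                            ∎

  -- − ⊗ B is a left adjoint, so P ⊗ B is the wide pushout of the q i ⊗ B:
  -- a map out of A ⊗ B factoring compatibly through every q i ⊗ B descends
  descendˡ : ∀ {B Z} (f : (Carrier ⊗₀ B) ⇒ Z) (g : ∀ i → (∣ N i ∣ ⊗₀ B) ⇒ Z) →
             (∀ i → g i ∘ (q i ⊗₁ id) ≈ f) → Σ ((P ⊗₀ B) ⇒ Z) λ F → F ∘ (p₀ ⊗₁ id) ≈ f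
  descendˡ f g factors = eval ∘ (u ⊗₁ id) , (begin
    (eval ∘ (u ⊗₁ id)) ∘ (p₀ ⊗₁ id)   ≈⟨ pullʳ (≈-sym ∘-⊗ˡ) ⟩
    eval ∘ ((u ∘ p₀) ⊗₁ id)           ≈⟨ ∘-congˡ (⊗-congʳ (proj₁ (proj₂ U))) ⟩
    eval ∘ (curry f ⊗₁ id)            ≈⟨ eval-curry f ⟩
    f                                 ∎)
    where
    U = universal (curry f) (λ i → curry (g i))
          (λ i → ≈-trans (curry-natural (g i) (q i)) (curry-cong (factors i)))
    u = proj₁ U

  -- the same for B ⊗ −, via the symmetry
  descendʳ : ∀ {B Z} (f : (B ⊗₀ Carrier) ⇒ Z) (g : ∀ i → (B ⊗₀ ∣ N i ∣) ⇒ Z) →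
             (∀ i → g i ∘ (id ⊗₁ q i) ≈ f) → Σ ((B ⊗₀ P) ⇒ Z) λ F → F ∘ (id ⊗₁ p₀) ≈ f
  descendʳ f g factors = F ∘ σ , (begin
    (F ∘ σ) ∘ (id ⊗₁ p₀)       ≈⟨ pullʳ (σ-natural _ _) ⟩
    F ∘ ((p₀ ⊗₁ id) ∘ σ)       ≈⟨ pullˡ (proj₂ D) ⟩
    (f ∘ σ) ∘ σ                ≈⟨ cancelInner σ-involutive ⟩
    f                          ∎)
    where
    D = descendˡ (f ∘ σ) (λ i → g i ∘ σ) (λ i → begin
          (g i ∘ σ) ∘ (q i ⊗₁ id)    ≈⟨ pullʳ (σ-natural _ _) ⟩
          g i ∘ ((id ⊗₁ q i) ∘ σ)    ≈⟨ pullˡ (factors i) ⟩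
          f ∘ σ                      ∎)
    F = proj₁ D

  actˡ : ∀ i → (∣ N i ∣ ⊗₀ Carrier) ⇒ P
  actˡ i = inj i ∘ (μ[ i ] ∘ (id ⊗₁ q i))

  actʳ : ∀ j → (Carrier ⊗₀ ∣ N j ∣) ⇒ P
  actʳ j = inj j ∘ (μ[ j ] ∘ (q j ⊗₁ id))

  actˡ-q : ∀ i → actˡ i ∘ (q i ⊗₁ id) ≈ p₀ ∘ μ
  actˡ-q i = ≈-trans (pullʳ (pullʳ ⊗-splitʳ)) (inj-μ i)

  actʳ-q : ∀ j → actʳ j ∘ (id ⊗₁ q j) ≈ p₀ ∘ μ
  actʳ-q j = ≈-trans (pullʳ (pullʳ ⊗-splitˡ)) (inj-μ j)

  -- by stability N i ⊗ N j is the pushout of q i ⊗ A and A ⊗ q j, so the two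
  -- partial multiplications glue to a multiplication  N i ⊗ N j → P
  glue : ∀ i j → Σ ((∣ N i ∣ ⊗₀ ∣ N j ∣) ⇒ P) λ u →
                   (u ∘ (id ⊗₁ q j) ≈ actˡ i) × (u ∘ (q i ⊗₁ id) ≈ actʳ j)
  glue i j = IsPushout.universal (E-stable (q i) (q j) (q-E i) (q-E j)) (actˡ i) (actʳ j)
               (≈-trans (actˡ-q i) (≈-sym (actʳ-q j)))

  multᵢ : ∀ i → Σ ((∣ N i ∣ ⊗₀ P) ⇒ P) λ F → F ∘ (id ⊗₁ p₀) ≈ actˡ i
  multᵢ i = descendʳ (actˡ i) (λ j → proj₁ (glue i j)) (λ j → proj₁ (proj₂ (glue i j)))

  mult₀ : Σ ((Carrier ⊗₀ P) ⇒ P) λ F → F ∘ (id ⊗₁ p₀) ≈ p₀ ∘ μ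
  mult₀ = descendʳ (p₀ ∘ μ) actʳ actʳ-q

  -- descending in the left factor, compatibility being checked after the
  -- epimorphism A ⊗ p₀
  mult : Σ ((P ⊗₀ P) ⇒ P) λ F → F ∘ (p₀ ⊗₁ id) ≈ proj₁ mult₀
  mult = descendˡ (proj₁ mult₀) (λ i → proj₁ (multᵢ i)) λ i →
    epic (E-⊗ id p₀ E-id p₀-E) _ _ (begin
      (proj₁ (multᵢ i) ∘ (q i ⊗₁ id)) ∘ (id ⊗₁ p₀)   ≈⟨ pullʳ ⊗-interchange ⟩
      proj₁ (multᵢ i) ∘ ((id ⊗₁ p₀) ∘ (q i ⊗₁ id))   ≈⟨ pullˡ (proj₂ (multᵢ i)) ⟩
      actˡ i ∘ (q i ⊗₁ id)                           ≈⟨ actˡ-q i ⟩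
      p₀ ∘ μ                                         ≈⟨ proj₂ mult₀ ⟨
      proj₁ mult₀ ∘ (id ⊗₁ p₀)                       ∎)

  μP : (P ⊗₀ P) ⇒ P
  μP = proj₁ mult

  ηP : unit ⇒ P
  ηP = p₀ ∘ η

  p₀-μ : μP ∘ (p₀ ⊗₁ p₀) ≈ p₀ ∘ μ
  p₀-μ = begin
    μP ∘ (p₀ ⊗₁ p₀)                  ≈⟨ ∘-congˡ ⊗-splitˡ ⟨
    μP ∘ ((p₀ ⊗₁ id) ∘ (id ⊗₁ p₀))   ≈⟨ pullˡ (proj₂ mult) ⟩
    proj₁ mult₀ ∘ (id ⊗₁ p₀)         ≈⟨ proj₂ mult₀ ⟩
    p₀ ∘ μ                           ∎

  p₀-μ-∘ : ∀ {B D} {f : B ⇒ Carrier} {g : D ⇒ Carrier} →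
           μP ∘ ((p₀ ∘ f) ⊗₁ (p₀ ∘ g)) ≈ p₀ ∘ (μ ∘ (f ⊗₁ g))
  p₀-μ-∘ = ≈-trans (∘-congˡ ⊗-homomorphism) (≈-trans (pullˡ p₀-μ) assoc)

  -- the monoid laws of P are those of A, transported along the epimorphisms
  -- built from p₀ by ⊗
  P-assoc : μP ∘ (μP ⊗₁ id) ≈ μP ∘ (id ⊗₁ μP) ∘ α⇒
  P-assoc = epic (E-⊗ _ _ (E-⊗ _ _ p₀-E p₀-E) p₀-E) _ _ (begin
    (μP ∘ (μP ⊗₁ id)) ∘ ((p₀ ⊗₁ p₀) ⊗₁ p₀)     ≈⟨ pullʳ ⊗-compose ⟩
    μP ∘ ((μP ∘ (p₀ ⊗₁ p₀)) ⊗₁ (id ∘ p₀))      ≈⟨ ∘-congˡ (⊗-resp-≈ p₀-μ (≈-trans identityˡ (≈-sym identityʳ))) ⟩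
    μP ∘ ((p₀ ∘ μ) ⊗₁ (p₀ ∘ id))               ≈⟨ p₀-μ-∘ ⟩
    p₀ ∘ (μ ∘ (μ ⊗₁ id))                       ≈⟨ ∘-congˡ μ-assoc ⟩
    p₀ ∘ (μ ∘ (id ⊗₁ μ) ∘ α⇒)                  ≈⟨ ∘-congˡ sym-assoc ⟩
    p₀ ∘ ((μ ∘ (id ⊗₁ μ)) ∘ α⇒)                ≈⟨ sym-assoc ⟩
    (p₀ ∘ (μ ∘ (id ⊗₁ μ))) ∘ α⇒                ≈⟨ ∘-congʳ p₀-μ-∘ ⟨
    (μP ∘ ((p₀ ∘ id) ⊗₁ (p₀ ∘ μ))) ∘ α⇒        ≈⟨ ∘-congʳ (∘-congˡ (⊗-resp-≈ (≈-trans identityʳ (≈-sym identityˡ)) (≈-sym p₀-μ))) ⟩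
    (μP ∘ ((id ∘ p₀) ⊗₁ (μP ∘ (p₀ ⊗₁ p₀)))) ∘ α⇒   ≈⟨ ∘-congʳ (∘-congˡ ⊗-homomorphism) ⟩
    (μP ∘ ((id ⊗₁ μP) ∘ (p₀ ⊗₁ (p₀ ⊗₁ p₀)))) ∘ α⇒  ≈⟨ ≈-trans assoc (∘-congˡ (pullʳ (≈-sym (α-natural _ _ _)))) ⟩
    μP ∘ ((id ⊗₁ μP) ∘ (α⇒ ∘ ((p₀ ⊗₁ p₀) ⊗₁ p₀)))  ≈⟨ ≈-trans (∘-congˡ sym-assoc) sym-assoc ⟩
    (μP ∘ (id ⊗₁ μP) ∘ α⇒) ∘ ((p₀ ⊗₁ p₀) ⊗₁ p₀)    ∎)

  P-identityˡ : μP ∘ (ηP ⊗₁ id) ≈ λ⇒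
  P-identityˡ = epic (E-⊗ _ _ (E-id {unit}) p₀-E) _ _ (begin
    (μP ∘ (ηP ⊗₁ id)) ∘ (id ⊗₁ p₀)    ≈⟨ pullʳ ⊗-splitˡ ⟩
    μP ∘ ((p₀ ∘ η) ⊗₁ p₀)             ≈⟨ ∘-congˡ (⊗-congˡ (≈-sym identityʳ)) ⟩
    μP ∘ ((p₀ ∘ η) ⊗₁ (p₀ ∘ id))      ≈⟨ p₀-μ-∘ ⟩
    p₀ ∘ (μ ∘ (η ⊗₁ id))              ≈⟨ ∘-congˡ μ-identityˡ ⟩
    p₀ ∘ λ⇒                           ≈⟨ λ-natural p₀ ⟩
    λ⇒ ∘ (id ⊗₁ p₀)                   ∎)

  P-identityʳ : μP ∘ (id ⊗₁ ηP) ≈ ρ⇒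
  P-identityʳ = epic (E-⊗ _ _ p₀-E (E-id {unit})) _ _ (begin
    (μP ∘ (id ⊗₁ ηP)) ∘ (p₀ ⊗₁ id)    ≈⟨ pullʳ ⊗-splitʳ ⟩
    μP ∘ (p₀ ⊗₁ (p₀ ∘ η))             ≈⟨ ∘-congˡ (⊗-congʳ (≈-sym identityʳ)) ⟩
    μP ∘ ((p₀ ∘ id) ⊗₁ (p₀ ∘ η))      ≈⟨ p₀-μ-∘ ⟩
    p₀ ∘ (μ ∘ (id ⊗₁ η))              ≈⟨ ∘-congˡ μ-identityʳ ⟩
    p₀ ∘ ρ⇒                           ≈⟨ ρ-natural p₀ ⟩
    ρ⇒ ∘ (p₀ ⊗₁ id)                   ∎)

  Syn : MonoidObj C M
  Syn = record
    { raw = record { Carrier = P ; μ = μP ; η = ηP }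
    ; isMonoid = record
      { μ-assoc = P-assoc ; μ-identityˡ = P-identityˡ ; μ-identityʳ = P-identityʳ } }

  p₀-hom : IsMonoidHom C M (MonoidObj.raw A) (MonoidObj.raw Syn) p₀
  p₀-hom = record { preserves-μ = ≈-sym p₀-μ ; preserves-η = ≈-refl }

  p₀-recognizes : Recognizes Syn p₀
  p₀-recognizes = proj₁ U , ≈-sym (proj₁ (proj₂ U))
    where
    U = universal L (λ i → proj₁ (q-recognizes i)) (λ i → ≈-sym (proj₂ (q-recognizes i)))

  -- each leg of the wide pushout is a monoid morphism (checked after the
  -- epimorphism q i ⊗ q i)
  inj-hom : ∀ i → IsMonoidHom C M (MonoidObj.raw (N i)) (MonoidObj.raw Syn) (inj i)
  inj-hom i = record
    { preserves-μ = epic (E-⊗ _ _ (q-E i) (q-E i)) _ _ (begin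
        (inj i ∘ μ[ i ]) ∘ (q i ⊗₁ q i)           ≈⟨ assoc ⟩
        inj i ∘ (μ[ i ] ∘ (q i ⊗₁ q i))           ≈⟨ inj-μ i ⟩
        p₀ ∘ μ                                    ≈⟨ p₀-μ ⟨
        μP ∘ (p₀ ⊗₁ p₀)                           ≈⟨ ∘-congˡ (⊗-resp-≈ (commute i) (commute i)) ⟨
        μP ∘ ((inj i ∘ q i) ⊗₁ (inj i ∘ q i))     ≈⟨ ∘-congˡ ⊗-homomorphism ⟩
        μP ∘ ((inj i ⊗₁ inj i) ∘ (q i ⊗₁ q i))    ≈⟨ sym-assoc ⟩
        (μP ∘ (inj i ⊗₁ inj i)) ∘ (q i ⊗₁ q i)    ∎)
    ; preserves-η = begin
        inj i ∘ MonoidObj.η (N i)   ≈⟨ ∘-congˡ (IsMonoidHom.preserves-η (q-hom i)) ⟨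
        inj i ∘ (q i ∘ η)           ≈⟨ pullˡ (commute i) ⟩
        p₀ ∘ η                      ∎ }

  p₀-least : (N' : MonoidObj C M) (f : Carrier ⇒ ∣ N' ∣) →
             IsMonoidHom C M (MonoidObj.raw A) (MonoidObj.raw N') f → E f → Recognizes N' f →
             Σ (∣ N' ∣ ⇒ P) λ g →
               IsMonoidHom C M (MonoidObj.raw N') (MonoidObj.raw Syn) g × (p₀ ≈ g ∘ f)
  p₀-least N' f f-hom f-E f-recognizes = inj i , inj-hom i , ≈-sym (commute i)
    where
    i : Recognizer
    i = record { N = N' ; q = f ; q-hom = f-hom ; q-E = f-E ; q-recognizes = f-recognizes }

corollary3p9 : {o ℓ e p : Level} (C : Category o ℓ e) →
    let open Category C in
    (M : Monoidal C) (S : Symmetric C M) (Cl : Closed C M) →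
    (CP : CountableCoproducts C) →
    (E : MorphClass C p) →
    RespectsEq C E →
    ConsistsOfEpis C E →
    ContainsIsos C E →
    ClosedUnderComposition C E →
    Stable C M E →
    ClosedUnderWidePushouts C E →
    ClosedUnderTensor C M E →
    HasWidePushoutsOf C E →
    (X Y : Obj) (L : FreeMonoid.X* C M S Cl CP X ⇒ Y) →
    FreeMonoid.SyntacticMonoid C M S Cl CP X E L
corollary3p9 C M S Cl CP E E-resp E-epi E-iso _ E-stable E-widePushout E-⊗ widePushouts X Y L =
  record
    { Syn = Syn
    ; eL = p₀
    ; eL-hom = p₀-hom
    ; eL-E = p₀-E
    ; eL-recognizes = p₀-recognizes
    ; eL-minimal = p₀-least }
  where
  open FreeMonoidLaws C M S Cl CP X using (X*-monoid)
  open SyntacticQuotient C M S Cl E E-resp E-epi E-iso E-stable E-widePushout E-⊗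
                         widePushouts X*-monoid L
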